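{- For all positive integers $n,d$, $\mathrm{spa}(V(n,d)^{ -1})\ge\mathrm{spa}(V(n,d))$.
   Context: $\mathbb{N}=\{0,1,2,\dots\}$; $B(n,d)=\{\alpha\in\mathbb{N}^n:\sum_i\alpha_i=d\}$ enumerated as $\alpha^1,\dots,\alpha^{s}$, $s=\binom{n+d-1}{d}$; $V(n,d)=[(\alpha^i)^{\alpha^j}]_{i,j}$ where $\alpha^{\beta}=\prod_k\alpha_k^{\beta_k}$ and $0^0=1$ ($V(n,d)$ is invertible). For a $p\times m$ matrix $M$, $\mathrm{spa}(M)=1-\mathrm{nnz}(M)/(pm)$, where $\mathrm{nnz}(M)$ is its number of nonzero entries. -}

module Defs where

open import Data.Nat as ℕ using (ℕ; zero; suc; _∸_)
open import Data.Integer using (+_)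
open import Data.Fin using (Fin)
open import Data.Fin.Properties as FinP using ()
open import Data.List as List using (List; []; _∷_; upTo; concatMap; map; allFin; length; lookup; foldr)
open import Data.Vec as Vec using (Vec; []; _∷_)
open import Data.Rational as ℚ using (ℚ; 0ℚ; 1ℚ; _/_; _-_)
open import Data.Rational.Properties as ℚP using ()
open import Relation.Nullary using (does)
open import Data.Bool using (if_then_else_)
open import Data.Nat.ListAction using (sum)
open import Relation.Binary.PropositionalEquality using (_≡_)

B : (n d : ℕ) → List (Vec ℕ n)
B zero zero = Vec.[] ∷ []
B zero (suc d) = []
B (suc n) d = concatMap (λ k → map (k Vec.∷_) (B n (d ∸ k))) (upTo (suc d))

size : (n d : ℕ) → ℕ
size n d = length (B n d)

-- α^β = ∏_k α_k^β_k  (ℕ's _^_ has 0^0 = 1)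
pow : ∀ {n} → Vec ℕ n → Vec ℕ n → ℕ
pow α β = Vec.foldr _ ℕ._*_ 1 (Vec.zipWith ℕ._^_ α β)

Mat : ℕ → ℕ → Set
Mat p m = Fin p → Fin m → ℚ

V : (n d : ℕ) → Mat (size n d) (size n d)
V n d i j = (+ pow (lookup (B n d) i) (lookup (B n d) j)) / 1

sumℚ : ∀ {k} → (Fin k → ℚ) → ℚ
sumℚ {k} f = foldr ℚ._+_ 0ℚ (map f (allFin k))

_⊗_ : ∀ {p q r} → Mat p q → Mat q r → Mat p r
(M ⊗ N) i j = sumℚ (λ k → M i k ℚ.* N k j)

Id : ∀ {p} → Mat p p
Id i j = if does (i FinP.≟ j) then 1ℚ else 0ℚ

_≡ₘ_ : ∀ {p m} → Mat p m → Mat p m → Set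
M ≡ₘ N = ∀ i j → M i j ≡ N i j

nnz : ∀ {p m} → Mat p m → ℕ
nnz {p} {m} M =
  sum (map (λ i → sum (map (λ j → if does (M i j ℚP.≟ 0ℚ) then 0 else 1) (allFin m))) (allFin p))

-- a / b as a rational (b = 0 case is a dummy, never used for nonempty matrices)
ratio : ℕ → ℕ → ℚ
ratio a zero = 0ℚ
ratio a (suc b) = (+ a) / suc b

spa : ∀ {p m} → Mat p m → ℚ
spa {p} {m} M = 1ℚ - ratio (nnz M) (p ℕ.* m)

{-# OPTIONS --safe #-}
module Submission where

-- Write α i for the i-th exponent vector.  The entry (α i)^(α j) of V vanishes exactly when
-- supp (α j) ⊄ supp (α i).  Fix a row i and let P be the set of l with supp (α l) ⊆ supp (α i):
-- rows in P vanish on the columns outside P, so V is block triangular for the split P / ¬ P,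
-- and a right inverse of a block triangular square matrix has the same zero block (a square
-- matrix with a right inverse is injective, since k + 1 vectors in ℚᵏ are linearly dependent).
-- If V i j = 0 then j ∉ P ∋ i, hence W i j = 0: W has at least the zeros of V.

open import Defs
open import Algebra.Bundles using (CommutativeRing)
open import Data.Bool using (if_then_else_)
open import Data.Empty using (⊥-elim)
open import Data.Fin using (Fin; zero; suc; punchIn)
open import Data.Fin.Properties as FinP using (punchInᵢ≢i; any?; all?; ¬∀⟶∃¬)
open import Data.Integer as ℤ using ()
open import Data.Integer.Properties as ℤP using ()
open import Data.List as List using (map; allFin; foldr; tabulate)
open import Data.List.Properties using (map-tabulate)
open import Data.Nat as ℕ using (ℕ; zero; suc; _^_; _≤_)
open import Data.Nat.ListAction using () renaming (sum to sumℕ)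
open import Data.Nat.Properties as NP using ()
open import Data.Product using (∃-syntax; ∃₂; _×_; _,_; proj₁; proj₂)
open import Data.Rational as ℚ using (ℚ; 0ℚ; 1ℚ; _+_; _*_; -_; _-_; 1/_; _/_) renaming (_≤_ to _≤ℚ_)
open import Data.Rational.Properties as ℚP using ()
open import Data.Rational.Solver using (module +-*-Solver)
open import Data.Rational.Unnormalised as ℚᵘ using (mkℚᵘ)
open import Data.Rational.Unnormalised.Properties as ℚᵘP using ()
open import Data.Sum using (inj₁; inj₂)
open import Data.Vec as Vec using (Vec)
open import Data.Vec.Functional using (Vector; _∷_; insertAt)
open import Data.Vec.Functional.Properties using (insertAt-lookup; insertAt-punchIn)
open import Function using (_∘_; id; const)
open import Level using (0ℓ)
open import Relation.Binary.PropositionalEquality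
open import Relation.Nullary using (¬_; Dec; yes; no; does; ¬?; contradiction)
open import Relation.Nullary.Decidable using (dec-true; dec-false; decidable-stable; _→-dec_)
open import Relation.Unary using (Pred; Decidable)

open ≡-Reasoning
open import Algebra.Properties.Semiring.Sum (CommutativeRing.semiring ℚP.+-*-commutativeRing)
  using (sum; sum-cong-≗; sum-replicate-zero; sum-remove; ∑-distrib-+; ∑-comm;
         *-distribˡ-sum; *-distribʳ-sum)

open +-*-Solver using (solve; _:+_; _:*_; _:-_; :-_; _:=_)
open import Algebra.Properties.Group ℚP.+-0-group using (inverseʳ-unique)

sumℚ≡sum : ∀ {k} (f : Fin k → ℚ) → sumℚ f ≡ sum f
sumℚ≡sum {zero} f = refl
sumℚ≡sum {suc k} f = cong (f zero +_) (begin
  foldr _+_ 0ℚ (map f (tabulate suc))        ≡⟨ cong (foldr _+_ 0ℚ) (map-tabulate suc f) ⟩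
  foldr _+_ 0ℚ (tabulate (f ∘ suc))          ≡⟨ cong (foldr _+_ 0ℚ) (map-tabulate id (f ∘ suc)) ⟨
  foldr _+_ 0ℚ (map (f ∘ suc) (allFin k))    ≡⟨ sumℚ≡sum (f ∘ suc) ⟩
  sum (f ∘ suc)                              ∎)

sum-zero : ∀ {k} {f : Vector ℚ k} → (∀ i → f i ≡ 0ℚ) → sum f ≡ 0ℚ
sum-zero {k} f≡0 = trans (sum-cong-≗ f≡0) (sum-replicate-zero k)

Id-diagonal : ∀ {k} (i : Fin k) → Id i i ≡ 1ℚ
Id-diagonal i rewrite dec-true (i FinP.≟ i) refl = refl

Id-offDiagonal : ∀ {k} {i j : Fin k} → i ≢ j → Id i j ≡ 0ℚ
Id-offDiagonal {i = i} {j} i≢j rewrite dec-false (i FinP.≟ j) i≢j = refl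

infixr 7 _·_

_·_ : ∀ {p q} → Mat p q → Vector ℚ q → Vector ℚ p
(M · x) i = sum λ j → M i j * x j

⊗≡· : ∀ {p q r} (A : Mat p q) (B : Mat q r) i j → (A ⊗ B) i j ≡ (A · λ l → B l j) i
⊗≡· A B i j = sumℚ≡sum (λ l → A i l * B l j)

·-congʳ : ∀ {p q} (M : Mat p q) {x y : Vector ℚ q} → (∀ j → x j ≡ y j) →
  ∀ i → (M · x) i ≡ (M · y) i
·-congʳ M x≡y i = sum-cong-≗ λ j → cong (M i j *_) (x≡y j)

·-zeroʳ : ∀ {p q} (M : Mat p q) i → (M · λ _ → 0ℚ) i ≡ 0ℚ
·-zeroʳ M i = sum-zero λ j → ℚP.*-zeroʳ (M i j)

·-*ʳ : ∀ {p q} (M : Mat p q) (x : Vector ℚ q) a i → (M · λ j → x j * a) i ≡ (M · x) i * a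
·-*ʳ M x a i = begin
  sum (λ j → M i j * (x j * a))   ≡⟨ sum-cong-≗ (λ j → ℚP.*-assoc (M i j) (x j) a) ⟨
  sum (λ j → M i j * x j * a)     ≡⟨ *-distribʳ-sum a (λ j → M i j * x j) ⟨
  (M · x) i * a                   ∎

Id-· : ∀ {k} (x : Vector ℚ k) i → (Id · x) i ≡ x i
Id-· {suc k} x i = begin
  (Id · x) i
    ≡⟨ sum-remove {i = i} (λ l → Id i l * x l) ⟩
  Id i i * x i + sum (λ l → Id i (punchIn i l) * x (punchIn i l))
    ≡⟨ cong₂ _+_ (cong (_* x i) (Id-diagonal i)) (sum-zero off) ⟩
  1ℚ * x i + 0ℚ
    ≡⟨ trans (ℚP.+-identityʳ (1ℚ * x i)) (ℚP.*-identityˡ (x i)) ⟩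
  x i ∎
  where
  off : ∀ l → Id i (punchIn i l) * x (punchIn i l) ≡ 0ℚ
  off l = trans (cong (_* x (punchIn i l)) (Id-offDiagonal (punchInᵢ≢i i l ∘ sym)))
                (ℚP.*-zeroˡ (x (punchIn i l)))

⊗-·-assoc : ∀ {p q r} (A : Mat p q) (B : Mat q r) x i → ((A ⊗ B) · x) i ≡ (A · (B · x)) i
⊗-·-assoc A B x i = begin
  sum (λ j → (A ⊗ B) i j * x j)
    ≡⟨ sum-cong-≗ (λ j → cong (_* x j) (⊗≡· A B i j)) ⟩
  sum (λ j → sum (λ l → A i l * B l j) * x j)
    ≡⟨ sum-cong-≗ (λ j → *-distribʳ-sum (x j) (λ l → A i l * B l j)) ⟩
  sum (λ j → sum (λ l → A i l * B l j * x j))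
    ≡⟨ ∑-comm (λ j l → A i l * B l j * x j) ⟩
  sum (λ l → sum (λ j → A i l * B l j * x j))
    ≡⟨ sum-cong-≗ (λ l → sum-cong-≗ (λ j → ℚP.*-assoc (A i l) (B l j) (x j))) ⟩
  sum (λ l → sum (λ j → A i l * (B l j * x j)))
    ≡⟨ sum-cong-≗ (λ l → *-distribˡ-sum (A i l) (λ j → B l j * x j)) ⟨
  (A · (B · x)) i ∎

·-rightInverse : ∀ {k} {A R : Mat k k} → (A ⊗ R) ≡ₘ Id → ∀ x i → (A · (R · x)) i ≡ x i
·-rightInverse {A = A} {R} AR x i = begin
  (A · (R · x)) i  ≡⟨ ⊗-·-assoc A R x i ⟨
  ((A ⊗ R) · x) i  ≡⟨ sum-cong-≗ (λ j → cong (_* x j) (AR i j)) ⟩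
  (Id · x) i       ≡⟨ Id-· x i ⟩
  x i              ∎

leftInverse⇒injective : ∀ {k} {A R : Mat k k} → (A ⊗ R) ≡ₘ Id →
  ∀ y → (∀ l → (R · y) l ≡ 0ℚ) → ∀ i → y i ≡ 0ℚ
leftInverse⇒injective {A = A} {R} AR y Ry≡0 i =
  trans (sym (·-rightInverse {A = A} {R} AR y i)) (trans (·-congʳ A Ry≡0 i) (·-zeroʳ A i))

pivot : ∀ {k} (u : Vector ℚ (suc k)) →
  ∃₂ λ j (q : Vector ℚ k) → ∀ i → u (punchIn j i) ≡ q i * u j
pivot u with any? (λ j → ¬? (u j ℚP.≟ 0ℚ))
... | yes (j , uj≢0) = j , (λ i → u (punchIn j i) * 1/ u j) , λ i → sym (begin
  u (punchIn j i) * 1/ u j * u j     ≡⟨ ℚP.*-assoc (u (punchIn j i)) (1/ u j) (u j) ⟩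
  u (punchIn j i) * (1/ u j * u j)   ≡⟨ cong (u (punchIn j i) *_) (ℚP.*-inverseˡ (u j)) ⟩
  u (punchIn j i) * 1ℚ               ≡⟨ ℚP.*-identityʳ (u (punchIn j i)) ⟩
  u (punchIn j i)                    ∎)
  where
  instance _ = ℚ.≢-nonZero uj≢0
... | no ∄u≢0 = zero , (λ _ → 0ℚ) , λ i →
  trans (decidable-stable (u (suc i) ℚP.≟ 0ℚ) (λ u≢0 → ∄u≢0 (suc i , u≢0)))
        (sym (ℚP.*-zeroˡ (u zero)))

-- Giving the pivot j the coefficient −Σ qᵢcᵢ cancels the multiple of u j that u carries
-- off the pivot.
sum-insertAt : ∀ {k} (u : Vector ℚ (suc k)) (n q c : Vector ℚ k) (j : Fin (suc k)) →
  (∀ i → u (punchIn j i) ≡ n i + q i * u j) →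
  sum (λ l → u l * insertAt c j (- sum (λ i → q i * c i)) l) ≡ sum (λ i → n i * c i)
sum-insertAt u n q c j u≡n+qu = begin
  sum (λ l → u l * c⁺ l)
    ≡⟨ sum-remove {i = j} (λ l → u l * c⁺ l) ⟩
  u j * c⁺ j + sum (λ i → u (punchIn j i) * c⁺ (punchIn j i))
    ≡⟨ cong₂ (λ a b → u j * a + b) (insertAt-lookup c j (- S))
             (sum-cong-≗ λ i → cong₂ _*_ (u≡n+qu i) (insertAt-punchIn c j (- S) i)) ⟩
  u j * - S + sum (λ i → (n i + q i * u j) * c i)
    ≡⟨ cong (u j * - S +_) (sum-cong-≗ distrib) ⟩
  u j * - S + sum (λ i → n i * c i + u j * (q i * c i))
    ≡⟨ cong (u j * - S +_) (∑-distrib-+ (λ i → n i * c i) (λ i → u j * (q i * c i))) ⟩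
  u j * - S + (N + sum (λ i → u j * (q i * c i)))
    ≡⟨ cong (λ z → u j * - S + (N + z)) (*-distribˡ-sum (u j) (λ i → q i * c i)) ⟨
  u j * - S + (N + u j * S)
    ≡⟨ solve 3 (λ a s t → a :* (:- s) :+ (t :+ a :* s) := t) refl (u j) S N ⟩
  N ∎
  where
  S = sum (λ i → q i * c i)
  N = sum (λ i → n i * c i)
  c⁺ = insertAt c j (- S)
  distrib : ∀ i → (n i + q i * u j) * c i ≡ n i * c i + u j * (q i * c i)
  distrib i = solve 4 (λ a q b x → (a :+ q :* b) :* x := a :* x :+ b :* (q :* x)) refl (n i) (q i) (u j) (c i)

NontrivialKernel : ∀ {p q} → Mat p q → Set
NontrivialKernel M = ∃[ c ] (∃[ i ] c i ≢ 0ℚ) × (∀ r → (M · c) r ≡ 0ℚ)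

-- Gaussian elimination: clear the first row outside a pivot column and recurse on the others.
wide-kernel : ∀ m (M : Mat m (suc m)) → NontrivialKernel M
wide-kernel zero M = (λ _ → 1ℚ) , (zero , λ ()) , λ ()
wide-kernel (suc m) M with pivot (M zero)
... | j , q , M₀≡qM₀j = extend (wide-kernel m N)
  where
  N : Mat m (suc m)
  N r i = M (suc r) (punchIn j i) - q i * M (suc r) j

  extend : NontrivialKernel N → NontrivialKernel M
  extend (c , (i₀ , ci₀≢0) , Nc≡0) = c⁺ , (punchIn j i₀ , c⁺≢0) , Mc⁺≡0
    where
    c⁺ = insertAt c j (- sum (λ i → q i * c i))
    c⁺≢0 : c⁺ (punchIn j i₀) ≢ 0ℚ
    c⁺≢0 = ci₀≢0 ∘ trans (sym (insertAt-punchIn c j _ i₀))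
    Mc⁺≡0 : ∀ r → (M · c⁺) r ≡ 0ℚ
    Mc⁺≡0 zero = trans
      (sum-insertAt (M zero) (λ _ → 0ℚ) q c j λ i → trans (M₀≡qM₀j i) (sym (ℚP.+-identityˡ _)))
      (sum-zero λ i → ℚP.*-zeroˡ (c i))
    Mc⁺≡0 (suc r) = trans (sum-insertAt (M (suc r)) (N r) q c j Mᵣ≡N+qMᵣ) (Nc≡0 r)
      where
      Mᵣ≡N+qMᵣ : ∀ i → M (suc r) (punchIn j i) ≡ N r i + q i * M (suc r) j
      Mᵣ≡N+qMᵣ i = solve 3 (λ a b x → a := (a :- b :* x) :+ b :* x) refl
        (M (suc r) (punchIn j i)) (q i) (M (suc r) j)

-- x and the columns of R are k + 1 vectors in ℚᵏ, so x c₀ + R c′ = 0 for some nonzero c = (c₀, c′).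
-- R is injective, so c₀ ≠ 0 and x = R z with z = − c′ / c₀; then z = A (R z) = A x = 0.
rightInverse⇒injective : ∀ {k} {A R : Mat k k} → (A ⊗ R) ≡ₘ Id →
  ∀ x → (∀ i → (A · x) i ≡ 0ℚ) → ∀ l → x l ≡ 0ℚ
rightInverse⇒injective {k} {A} {R} AR x Ax≡0 with wide-kernel k (λ l → x l ∷ R l)
... | c , (i₀ , ci₀≢0) , xc₀+Rc′≡0 with c zero ℚP.≟ 0ℚ
... | yes c₀≡0 = ⊥-elim (ci₀≢0 (c≡0 i₀))
  where
  Rc′≡0 : ∀ l → (R · c ∘ suc) l ≡ 0ℚ
  Rc′≡0 l = begin
    (R · c ∘ suc) l    ≡⟨ inverseʳ-unique (x l * c zero) _ (xc₀+Rc′≡0 l) ⟩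
    - (x l * c zero)   ≡⟨ cong (λ c₀ → - (x l * c₀)) c₀≡0 ⟩
    - (x l * 0ℚ)       ≡⟨ cong -_ (ℚP.*-zeroʳ (x l)) ⟩
    0ℚ                 ∎
  c≡0 : ∀ i → c i ≡ 0ℚ
  c≡0 zero = c₀≡0
  c≡0 (suc i) = leftInverse⇒injective {A = A} {R} AR (c ∘ suc) Rc′≡0 i
... | no c₀≢0 = λ l → trans (x≡Rz l) (trans (·-congʳ R z≡0 l) (·-zeroʳ R l))
  where
  instance _ = ℚ.≢-nonZero c₀≢0
  z : Vector ℚ k
  z j = c (suc j) * - 1/ c zero
  x≡Rz : ∀ l → x l ≡ (R · z) l
  x≡Rz l = sym (begin
    (R · z) l
      ≡⟨ ·-*ʳ R (c ∘ suc) (- 1/ c zero) l ⟩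
    (R · c ∘ suc) l * - 1/ c zero
      ≡⟨ cong (_* - 1/ c zero) (inverseʳ-unique (x l * c zero) _ (xc₀+Rc′≡0 l)) ⟩
    - (x l * c zero) * - 1/ c zero
      ≡⟨ solve 3 (λ a b d → (:- (a :* b)) :* (:- d) := a :* (d :* b)) refl (x l) (c zero) (1/ c zero) ⟩
    x l * (1/ c zero * c zero)
      ≡⟨ cong (x l *_) (ℚP.*-inverseˡ (c zero)) ⟩
    x l * 1ℚ
      ≡⟨ ℚP.*-identityʳ (x l) ⟩
    x l ∎)
  z≡0 : ∀ j → z j ≡ 0ℚ
  z≡0 j = begin
    z j                  ≡⟨ ·-rightInverse {A = A} {R} AR z j ⟨
    (A · (R · z)) j      ≡⟨ ·-congʳ A x≡Rz j ⟨
    (A · x) j            ≡⟨ Ax≡0 j ⟩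
    0ℚ                   ∎

module _ {k} {M W : Mat k k} (MW : (M ⊗ W) ≡ₘ Id) {P : Pred (Fin k) 0ℓ} (P? : Decidable P)
         (M-zeroBlock : ∀ {i j} → P i → ¬ P j → M i j ≡ 0ℚ) where

  private
    P-separates : ∀ {i j} → P i → ¬ P j → i ≢ j
    P-separates Pi ¬Pj refl = ¬Pj Pi

    ·-restrict : ∀ {i} {x y : Vector ℚ k} → P i → (∀ l → P l → x l ≡ y l) →
      (M · x) i ≡ (M · y) i
    ·-restrict {i} {x} {y} Pi x≡y = sum-cong-≗ M*x≡M*y
      where
      M*x≡M*y : ∀ l → M i l * x l ≡ M i l * y l
      M*x≡M*y l with P? l
      ... | yes Pl = cong (M i l *_) (x≡y l Pl)
      ... | no ¬Pl rewrite M-zeroBlock Pi ¬Pl = trans (ℚP.*-zeroˡ (x l)) (sym (ℚP.*-zeroˡ (y l)))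

    -- Since the rows of M in P vanish off P, filling in Id outside them keeps AR = Id.
    A : Mat k k
    A i l with P? i
    ... | yes _ = M i l
    ... | no _ = Id i l

    R : Mat k k
    R l j with P? l | P? j
    ... | yes _ | yes _ = W l j
    ... | _     | _     = Id l j

    A·≡M· : ∀ {i} (x : Vector ℚ k) → P i → (A · x) i ≡ (M · x) i
    A·≡M· {i} x Pi with P? i
    ... | yes _ = refl
    ... | no ¬Pi = contradiction Pi ¬Pi

    A·≡Id· : ∀ {i} (x : Vector ℚ k) → ¬ P i → (A · x) i ≡ (Id · x) i
    A·≡Id· {i} x ¬Pi with P? i
    ... | yes Pi = contradiction Pi ¬Pi
    ... | no _ = refl

    R-inside : ∀ {l j} → P l → P j → R l j ≡ W l j
    R-inside {l} {j} Pl Pj with P? l | P? j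
    ... | yes _ | yes _ = refl
    ... | no ¬Pl | _ = contradiction Pl ¬Pl
    ... | yes _ | no ¬Pj = contradiction Pj ¬Pj

    R-outside : ∀ {l j} → ¬ (P l × P j) → R l j ≡ Id l j
    R-outside {l} {j} ¬PlPj with P? l | P? j
    ... | yes Pl | yes Pj = contradiction (Pl , Pj) ¬PlPj
    ... | yes _ | no _ = refl
    ... | no _ | _ = refl

    AR≡Id : (A ⊗ R) ≡ₘ Id
    AR≡Id i j = entry (P? i) (P? j)
      where
      entry : Dec (P i) → Dec (P j) → (A ⊗ R) i j ≡ Id i j
      entry (yes Pi) (yes Pj) = begin
        (A ⊗ R) i j               ≡⟨ ⊗≡· A R i j ⟩
        (A · λ l → R l j) i       ≡⟨ A·≡M· (λ l → R l j) Pi ⟩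
        (M · λ l → R l j) i       ≡⟨ ·-restrict Pi (λ l Pl → R-inside Pl Pj) ⟩
        (M · λ l → W l j) i       ≡⟨ ⊗≡· M W i j ⟨
        (M ⊗ W) i j               ≡⟨ MW i j ⟩
        Id i j                    ∎
      entry (yes Pi) (no ¬Pj) = begin
        (A ⊗ R) i j               ≡⟨ ⊗≡· A R i j ⟩
        (A · λ l → R l j) i       ≡⟨ A·≡M· (λ l → R l j) Pi ⟩
        (M · λ l → R l j) i       ≡⟨ ·-restrict Pi R≡0 ⟩
        (M · λ _ → 0ℚ) i          ≡⟨ ·-zeroʳ M i ⟩
        0ℚ                        ≡⟨ Id-offDiagonal (P-separates Pi ¬Pj) ⟨
        Id i j                    ∎
        where
        R≡0 : ∀ l → P l → R l j ≡ 0ℚ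
        R≡0 l Pl = trans (R-outside (¬Pj ∘ proj₂)) (Id-offDiagonal (P-separates Pl ¬Pj))
      entry (no ¬Pi) _ = begin
        (A ⊗ R) i j               ≡⟨ ⊗≡· A R i j ⟩
        (A · λ l → R l j) i       ≡⟨ A·≡Id· (λ l → R l j) ¬Pi ⟩
        (Id · λ l → R l j) i      ≡⟨ Id-· (λ l → R l j) i ⟩
        R i j                     ≡⟨ R-outside (¬Pi ∘ proj₁) ⟩
        Id i j                    ∎

  rightInverse-zeroBlock : ∀ {i j} → P i → ¬ P j → W i j ≡ 0ℚ
  rightInverse-zeroBlock {i} {j} Pi ¬Pj = begin
    W i j    ≡⟨ x-inside Pi ⟨
    x i      ≡⟨ rightInverse⇒injective {A = A} {R} AR≡Id x Ax≡0 i ⟩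
    0ℚ       ∎
    where
    x : Vector ℚ k
    x l with P? l
    ... | yes _ = W l j
    ... | no _ = 0ℚ
    x-inside : ∀ {l} → P l → x l ≡ W l j
    x-inside {l} Pl with P? l
    ... | yes _ = refl
    ... | no ¬Pl = contradiction Pl ¬Pl
    x-outside : ∀ {l} → ¬ P l → x l ≡ 0ℚ
    x-outside {l} ¬Pl with P? l
    ... | yes Pl = contradiction Pl ¬Pl
    ... | no _ = refl
    Ax≡0 : ∀ l → (A · x) l ≡ 0ℚ
    Ax≡0 l = row (P? l)
      where
      row : Dec (P l) → (A · x) l ≡ 0ℚ
      row (yes Pl) = begin
        (A · x) l             ≡⟨ A·≡M· x Pl ⟩
        (M · x) l             ≡⟨ ·-restrict Pl (λ _ → x-inside) ⟩
        (M · λ l → W l j) l   ≡⟨ ⊗≡· M W l j ⟨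
        (M ⊗ W) l j           ≡⟨ MW l j ⟩
        Id l j                ≡⟨ Id-offDiagonal (P-separates Pl ¬Pj) ⟩
        0ℚ                    ∎
      row (no ¬Pl) = trans (A·≡Id· x ¬Pl) (trans (Id-· x l) (x-outside ¬Pl))

infix 4 _⊑_

_⊑_ : ∀ {n} → Vec ℕ n → Vec ℕ n → Set
β ⊑ α = ∀ k → Vec.lookup α k ≡ 0 → Vec.lookup β k ≡ 0

_⊑?_ : ∀ {n} (β α : Vec ℕ n) → Dec (β ⊑ α)
β ⊑? α = all? λ k → (Vec.lookup α k ℕ.≟ 0) →-dec (Vec.lookup β k ℕ.≟ 0)

⊑-refl : ∀ {n} {α : Vec ℕ n} → α ⊑ α
⊑-refl _ α≡0 = α≡0

pow≡0 : ∀ {n} (α β : Vec ℕ n) k → Vec.lookup α k ≡ 0 → Vec.lookup β k ≢ 0 → pow α β ≡ 0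
pow≡0 (x Vec.∷ α) (zero Vec.∷ β)  zero    x≡0 y≢0 = contradiction refl y≢0
pow≡0 (x Vec.∷ α) (suc y Vec.∷ β) zero    refl _ = refl
pow≡0 (x Vec.∷ α) (y Vec.∷ β)     (suc k) αk≡0 βk≢0 =
  trans (cong (x ^ y ℕ.*_) (pow≡0 α β k αk≡0 βk≢0)) (NP.*-zeroʳ (x ^ y))

pow≢0 : ∀ {n} (α β : Vec ℕ n) → β ⊑ α → pow α β ≢ 0
pow≢0 Vec.[] Vec.[] _ ()
pow≢0 (x Vec.∷ α) (y Vec.∷ β) β⊑α xy*pow≡0 with NP.m*n≡0⇒m≡0∨n≡0 (x ^ y) xy*pow≡0
... | inj₂ pow≡0 = pow≢0 α β (β⊑α ∘ suc) pow≡0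
... | inj₁ x^y≡0 = 0^y≢0 (β⊑α zero x≡0) (subst (λ z → z ^ y ≡ 0) x≡0 x^y≡0)
  where
  x≡0 = NP.m^n≡0⇒m≡0 x y x^y≡0
  0^y≢0 : y ≡ 0 → 0 ^ y ≢ 0
  0^y≢0 refl ()

⊑-pow≡0 : ∀ {n} (α β : Vec ℕ n) {γ} → α ⊑ γ → ¬ β ⊑ γ → pow α β ≡ 0
⊑-pow≡0 α β {γ} α⊑γ β⋢γ
  with ¬∀⟶∃¬ _ _ (λ k → (Vec.lookup γ k ℕ.≟ 0) →-dec (Vec.lookup β k ℕ.≟ 0)) β⋢γ
... | k , ¬[γk≡0→βk≡0] = pow≡0 α β k (α⊑γ k γk≡0) (¬[γk≡0→βk≡0] ∘ const)
  where
  γk≡0 : Vec.lookup γ k ≡ 0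
  γk≡0 = decidable-stable (Vec.lookup γ k ℕ.≟ 0)
    (λ γk≢0 → ¬[γk≡0→βk≡0] (λ γk≡0 → contradiction γk≡0 γk≢0))

PowMatrix : ∀ {s n} → (Fin s → Vec ℕ n) → Mat s s
PowMatrix α i j = (ℤ.+ pow (α i) (α j)) / 1

ℕ/1≢0 : ∀ m .{{_ : ℕ.NonZero m}} → (ℤ.+ m) / 1 ≢ 0ℚ
ℕ/1≢0 m = ≢-sym (ℚP.<⇒≢ (ℚP.positive⁻¹ ((ℤ.+ m) / 1) {{ℚP.normalize-pos m 1}}))

PowMatrix-rightInverse-zeros : ∀ {s n} (α : Fin s → Vec ℕ n) {W : Mat s s} →
  (PowMatrix α ⊗ W) ≡ₘ Id → ∀ i j → PowMatrix α i j ≡ 0ℚ → W i j ≡ 0ℚ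
PowMatrix-rightInverse-zeros α VW i j Vij≡0 =
  rightInverse-zeroBlock VW (λ l → α l ⊑? α i) zeroBlock (⊑-refl {α = α i}) αj⋢αi
  where
  zeroBlock : ∀ {l m} → α l ⊑ α i → ¬ α m ⊑ α i → PowMatrix α l m ≡ 0ℚ
  zeroBlock {l} {m} αl⊑αi αm⋢αi =
    cong (λ e → (ℤ.+ e) / 1) (⊑-pow≡0 (α l) (α m) {α i} αl⊑αi αm⋢αi)
  αj⋢αi : ¬ α j ⊑ α i
  αj⋢αi αj⊑αi =
    ℕ/1≢0 (pow (α i) (α j)) {{ℕ.≢-nonZero (pow≢0 (α i) (α j) αj⊑αi)}} Vij≡0

sumℕ-map-mono : ∀ {A : Set} {f g : A → ℕ} → (∀ a → f a ≤ g a) →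
  ∀ xs → sumℕ (map f xs) ≤ sumℕ (map g xs)
sumℕ-map-mono f≤g List.[]       = ℕ.z≤n
sumℕ-map-mono f≤g (x List.∷ xs) = NP.+-mono-≤ (f≤g x) (sumℕ-map-mono f≤g xs)

nonzero-indicator-mono : ∀ {a b : ℚ} → (a ≡ 0ℚ → b ≡ 0ℚ) →
  (if does (b ℚP.≟ 0ℚ) then 0 else 1) ≤ (if does (a ℚP.≟ 0ℚ) then 0 else 1)
nonzero-indicator-mono {a} {b} a≡0⇒b≡0 with a ℚP.≟ 0ℚ | b ℚP.≟ 0ℚ
... | yes a≡0 | no b≢0 = contradiction (a≡0⇒b≡0 a≡0) b≢0
... | yes _   | yes _  = ℕ.z≤n
... | no _    | yes _  = ℕ.z≤n
... | no _    | no _   = NP.≤-refl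

nnz-mono : ∀ {p m} {M N : Mat p m} → (∀ i j → M i j ≡ 0ℚ → N i j ≡ 0ℚ) → nnz N ≤ nnz M
nnz-mono {p} {m} zeros⊆ =
  sumℕ-map-mono (λ i → sumℕ-map-mono (λ j → nonzero-indicator-mono (zeros⊆ i j)) (allFin m))
                (allFin p)

ratio-monoˡ : ∀ {a b} c → a ≤ b → ratio a c ≤ℚ ratio b c
ratio-monoˡ zero    _   = ℚP.≤-refl
ratio-monoˡ {a} {b} (suc c) a≤b = ℚP.toℚᵘ-cancel-≤
  (ℚᵘP.≤-respˡ-≃ (ℚᵘP.≃-sym (ℚP.toℚᵘ-fromℚᵘ (mkℚᵘ (ℤ.+ a) c)))
  (ℚᵘP.≤-respʳ-≃ (ℚᵘP.≃-sym (ℚP.toℚᵘ-fromℚᵘ (mkℚᵘ (ℤ.+ b) c)))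
    (ℚᵘ.*≤* (ℤP.*-monoʳ-≤-nonNeg (ℤ.+ suc c) (ℤ.+≤+ a≤b)))))

spa-mono : ∀ {p m} (M N : Mat p m) → (∀ i j → M i j ≡ 0ℚ → N i j ≡ 0ℚ) → spa M ≤ℚ spa N
spa-mono {p} {m} _ _ zeros⊆ =
  ℚP.+-monoʳ-≤ 1ℚ (ℚP.neg-antimono-≤ (ratio-monoˡ (p ℕ.* m) (nnz-mono zeros⊆)))

theorem5 : (n d : ℕ) → 1 ≤ n → 1 ≤ d →
    (W : Mat (size n d) (size n d)) →
    (V n d ⊗ W) ≡ₘ Id → (W ⊗ V n d) ≡ₘ Id →
    spa (V n d) ≤ℚ spa W
theorem5 n d _ _ W VW _ = spa-mono (V n d) W (PowMatrix-rightInverse-zeros (List.lookup (B n d)) VW)
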